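{- Let $m,n,s,k,t$ be positive integers. If there exists an $\mathrm{H}_t(m,n;s,k)$, then for every positive divisor $\lambda$ of $t$ there exists a ${}^{\lambda}\mathrm{H}_{t/\lambda}(m,n;s,k)$.
   Context: A partially filled (p.f.) $m\times n$ array is an $m\times n$ matrix in which some cells may be empty. For positive integers $\mu,\tau$ with $\tau$ dividing $\frac{2nk}{\mu}$, put $w=\frac{2nk}{\mu}+\tau$ and let $J$ be the subgroup of $\mathbb{Z}_w$ of order $\tau$. A $\mu$-fold Heffter array over $\mathbb{Z}_w$ relative to $J$, denoted ${}^{\mu}\mathrm{H}_\tau(m,n;s,k)$, is an $m\times n$ p.f. array with entries in $\mathbb{Z}_w$ such that: (a) each row has exactly $s$ filled cells and each column exactly $k$ filled cells; (b) the multiset $\{\pm x : x \text{ an entry of a filled cell}\}$ (with multiplicity over all filled cells) contains each element of $\mathbb{Z}_w\setminus J$ exactly $\mu$ times; (c) the entries of every row and every column sum to $0$ in $\mathbb{Z}_w$. When $\mu=1$ the prefix is omitted: $\mathrm{H}_t(m,n;s,k)={}^{1}\mathrm{H}_t(m,n;s,k)$ (a relative Heffter array over $\mathbb{Z}_{2nk+t}$). -}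

module Defs where

open import Data.Nat using (ℕ; zero; suc; _+_; _*_; _<_)
open import Data.Nat.Divisibility using (_∣_; _∣?_)
open import Data.Nat.Properties using (_≟_)
open import Data.Fin using (Fin; toℕ)
open import Data.Nat.ListAction using (sum)
open import Data.List using (List; []; _∷_; map; length; filter; concatMap)
open import Data.List using (allFin)
open import Data.Maybe using (Maybe; just; nothing)
open import Data.Product using (Σ; _×_; _,_)
open import Relation.Nullary using (¬_; Dec; yes; no)
open import Relation.Binary.PropositionalEquality using (_≡_)

-- A partially filled m × n array over Z_w: a cell is either empty (nothing)
-- or contains an element of Z_w, represented as Fin w.
PFArray : ℕ → ℕ → ℕ → Set
PFArray m n w = Fin m → Fin n → Maybe (Fin w)

filled : ∀ {w} → List (Maybe (Fin w)) → List (Fin w)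
filled [] = []
filled (nothing ∷ xs) = filled xs
filled (just x ∷ xs) = x ∷ filled xs

rowCells : ∀ {m n w} → PFArray m n w → Fin m → List (Fin w)
rowCells {n = n} A i = filled (map (λ j → A i j) (allFin n))

colCells : ∀ {m n w} → PFArray m n w → Fin n → List (Fin w)
colCells {m = m} A j = filled (map (λ i → A i j) (allFin m))

allEntries : ∀ {m n w} → PFArray m n w → List (Fin w)
allEntries {m = m} A = concatMap (rowCells A) (allFin m)

-- sum of a list of elements of Z_w, as a natural number (to be read mod w)
sumℕ : ∀ {w} → List (Fin w) → ℕ
sumℕ xs = sum (map toℕ xs)

countEq : ∀ {w} → Fin w → List (Fin w) → ℕ
countEq z [] = 0
countEq z (x ∷ xs) with toℕ x ≟ toℕ z
... | yes _ = suc (countEq z xs)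
... | no _ = countEq z xs

-- number of list elements x with -x = z in Z_w, i.e. w ∣ z + x
countNeg : ∀ {w} → Fin w → List (Fin w) → ℕ
countNeg z [] = 0
countNeg {w} z (x ∷ xs) with w ∣? (toℕ z + toℕ x)
... | yes _ = suc (countNeg z xs)
... | no _ = countNeg z xs

-- multiplicity of z in the multiset {±x : x a filled entry}
multPM : ∀ {m n w} → PFArray m n w → Fin w → ℕ
multPM A z = countEq z (allEntries A) + countNeg z (allEntries A)

-- z lies in the subgroup J of Z_w of order τ (τ ∣ w): J = {z : τ z = 0 in Z_w}
inJ : (w τ : ℕ) → Fin w → Set
inJ w τ z = w ∣ τ * toℕ z

-- A μ-fold Heffter array ^μH_τ(m,n;s,k) over Z_w with w = d + τ, d = 2nk/μ,
-- relative to the subgroup J of order τ.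
record IsHeffter (μ τ m n s k d : ℕ) (A : PFArray m n (d + τ)) : Set where
  field
    rowFill : ∀ i → length (rowCells A i) ≡ s
    colFill : ∀ j → length (colCells A j) ≡ k
    multOut : ∀ z → ¬ inJ (d + τ) τ z → multPM A z ≡ μ
    multIn  : ∀ z → inJ (d + τ) τ z → multPM A z ≡ 0
    rowSum  : ∀ i → (d + τ) ∣ sumℕ (rowCells A i)
    colSum  : ∀ j → (d + τ) ∣ sumℕ (colCells A j)

Heffter : (μ τ m n s k : ℕ) → Set
Heffter μ τ m n s k =
  Σ ℕ λ d → (μ * d ≡ 2 * n * k) × (τ ∣ d) ×
    Σ (PFArray m n (d + τ)) λ A → IsHeffter μ τ m n s k d A

-- Reduce every entry modulo w′ = w / λ, where w = 2nk + t and w′ = 2nk/λ + t/λ. Reduction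
-- Z_w → Z_w′ is a homomorphism, so row and column sums stay 0 and it commutes with negation.
-- Each residue c of Z_w′ has exactly the λ preimages c + j w′ (j < λ), so the multiplicity of c
-- in the ±-multiset of the reduced array is a sum of λ multiplicities in the original array.
-- The subgroup of order t is precisely the preimage of the subgroup of order t/λ, so these
-- multiplicities are all 1 when c lies outside it and all 0 when c lies inside.
module Submission where

open import Defs
open import Data.Nat using (ℕ; zero; suc; _+_; _*_; _∸_; _<_; _≤_; NonZero; s≤s⁻¹; >-nonZero)
open import Data.Nat.Properties
open import Data.Nat.DivMod
open import Data.Nat.Divisibility
open import Data.Nat.ListAction using (sum)
open import Algebra.Properties.CommutativeSemigroup *-commutativeSemigroup using () renaming (x∙yz≈y∙xz to *-left-comm)
open import Algebra.Properties.CommutativeSemigroup +-commutativeSemigroup using () renaming (interchange to +-interchange; x∙yz≈y∙xz to +-left-comm)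
open import Data.Fin using (Fin; toℕ; fromℕ<)
open import Data.Fin.Properties using (toℕ<n; toℕ-fromℕ<; toℕ-injective)
open import Data.List using (List; []; _∷_; map; length; allFin; _++_)
open import Data.List.Properties using (length-map; map-++; map-∘; map-cong; map-concatMap; concatMap-cong)
open import Data.List.Relation.Unary.All using (All; []; _∷_; universal)
import Data.List.Relation.Unary.All.Properties as All
import Data.Maybe as Maybe
open import Data.Maybe using (just; nothing)
open import Data.Product using (_,_)
open import Data.Empty using (⊥-elim)
open import Function using (_∘_; _⇔_; mk⇔; Equivalence)
open import Relation.Nullary using (¬_; yes; no)
open import Relation.Binary.PropositionalEquality

δ : ℕ → ℕ → ℕ
δ x c with x ≟ c
... | yes _ = 1
... | no _ = 0

δ-≡ : ∀ {x c} → x ≡ c → δ x c ≡ 1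
δ-≡ {x} {c} x≡c with x ≟ c
... | yes _ = refl
... | no x≢c = ⊥-elim (x≢c x≡c)

δ-≢ : ∀ {x c} → ¬ x ≡ c → δ x c ≡ 0
δ-≢ {x} {c} x≢c with x ≟ c
... | yes x≡c = ⊥-elim (x≢c x≡c)
... | no _ = refl

δ-cong : ∀ {a b c d} → (a ≡ b ⇔ c ≡ d) → δ a b ≡ δ c d
δ-cong {a} {b} a≡b⇔c≡d with a ≟ b
... | yes a≡b = sym (δ-≡ (Equivalence.to a≡b⇔c≡d a≡b))
... | no a≢b = sym (δ-≢ (a≢b ∘ Equivalence.from a≡b⇔c≡d))

occ : ℕ → List ℕ → ℕ
occ c [] = 0
occ c (x ∷ xs) = δ x c + occ c xs

occ-++ : ∀ c xs ys → occ c (xs ++ ys) ≡ occ c xs + occ c ys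
occ-++ c [] ys = refl
occ-++ c (x ∷ xs) ys = trans (cong (δ x c +_) (occ-++ c xs ys)) (sym (+-assoc (δ x c) _ _))

countEq≡occ : ∀ {w} (z : Fin w) xs → countEq z xs ≡ occ (toℕ z) (map toℕ xs)
countEq≡occ z [] = refl
countEq≡occ z (x ∷ xs) with toℕ x ≟ toℕ z
... | yes _ = cong suc (countEq≡occ z xs)
... | no _ = countEq≡occ z xs

Σ< : ℕ → (ℕ → ℕ) → ℕ
Σ< zero f = 0
Σ< (suc l) f = Σ< l f + f l

syntax Σ< l (λ j → e) = ∑[ j < l ] e

Σ<-cong : ∀ l {f g} → (∀ j → j < l → f j ≡ g j) → Σ< l f ≡ Σ< l g
Σ<-cong zero f≡g = refl
Σ<-cong (suc l) f≡g = cong₂ _+_ (Σ<-cong l (λ j j<l → f≡g j (m<n⇒m<1+n j<l))) (f≡g l (n<1+n l))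

Σ<-distrib-+ : ∀ l f g → ∑[ j < l ] (f j + g j) ≡ Σ< l f + Σ< l g
Σ<-distrib-+ zero f g = refl
Σ<-distrib-+ (suc l) f g = trans (cong (_+ (f l + g l)) (Σ<-distrib-+ l f g)) (+-interchange (Σ< l f) (Σ< l g) (f l) (g l))

Σ<-const : ∀ l v {f} → (∀ j → j < l → f j ≡ v) → Σ< l f ≡ l * v
Σ<-const zero v f≡v = refl
Σ<-const (suc l) v f≡v =
  trans (cong₂ _+_ (Σ<-const l v (λ j j<l → f≡v j (m<n⇒m<1+n j<l))) (f≡v l (n<1+n l))) (+-comm (l * v) v)

Σ<-δ-≥ : ∀ l q → l ≤ q → ∑[ j < l ] δ q j ≡ 0
Σ<-δ-≥ l q l≤q = trans (Σ<-const l 0 (λ j j<l → δ-≢ (λ q≡j → <⇒≱ j<l (subst (l ≤_) q≡j l≤q)))) (*-zeroʳ l)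

Σ<-δ-< : ∀ l q → q < l → ∑[ j < l ] δ q j ≡ 1
Σ<-δ-< (suc l) q q<1+l with q ≟ l
... | yes q≡l = cong₂ _+_ (Σ<-δ-≥ l q (≤-reflexive (sym q≡l))) refl
... | no q≢l = cong₂ _+_ (Σ<-δ-< l q (≤∧≢⇒< (s≤s⁻¹ q<1+l) q≢l)) refl

δ-fibre : ∀ l W .{{_ : NonZero W}} {x c} → x < l * W → c < W →
  ∑[ j < l ] δ x (c + j * W) ≡ δ (x % W) c
δ-fibre l W {x} {c} x<lW c<W with x % W ≟ c
... | yes x%W≡c = trans (Σ<-cong l (λ j _ → δ-cong (mk⇔ quotient-≡ (trans x≡c+qW ∘ cong (λ v → c + v * W)))))
                        (Σ<-δ-< l (x / W) (m<n*o⇒m/o<n x<lW))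
  where
  x≡c+qW : x ≡ c + (x / W) * W
  x≡c+qW = trans (m≡m%n+[m/n]*n x W) (cong (_+ (x / W) * W) x%W≡c)
  quotient-≡ : ∀ {j} → x ≡ c + j * W → x / W ≡ j
  quotient-≡ {j} x≡c+jW = *-cancelʳ-≡ (x / W) j W (+-cancelˡ-≡ c _ _ (trans (sym x≡c+qW) x≡c+jW))
... | no x%W≢c = trans (Σ<-const l 0 (λ j _ → δ-≢ (x%W≢c ∘ residue {j}))) (*-zeroʳ l)
  where
  residue : ∀ {j} → x ≡ c + j * W → x % W ≡ c
  residue {j} x≡c+jW = trans (cong (_% W) x≡c+jW) (trans ([m+kn]%n≡m%n c j W) (m<n⇒m%n≡m c<W))

occ-map-% : ∀ l W .{{_ : NonZero W}} {c xs} → c < W → All (_< l * W) xs →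
  occ c (map (_% W) xs) ≡ ∑[ j < l ] occ (c + j * W) xs
occ-map-% l W c<W [] = sym (trans (Σ<-const l 0 (λ _ _ → refl)) (*-zeroʳ l))
occ-map-% l W {c} {x ∷ xs} c<W (x<lW ∷ xs<lW) =
  trans (cong₂ _+_ (sym (δ-fibre l W x<lW c<W)) (occ-map-% l W c<W xs<lW))
        (sym (Σ<-distrib-+ l (λ j → δ x (c + j * W)) (λ j → occ (c + j * W) xs)))

residue-unique : ∀ M .{{_ : NonZero M}} {a b y} → a < M → b < M → M ∣ a + y → M ∣ b + y → a ≡ b
residue-unique M {a} {b} {y} a<M b<M M∣a+y M∣b+y = begin
  a                 ≡⟨ sym (m<n⇒m%n≡m a<M) ⟩
  a % M             ≡⟨ sym (%-remove-+ʳ a M∣b+y) ⟩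
  (a + (b + y)) % M ≡⟨ cong (_% M) (+-left-comm a b y) ⟩
  (b + (a + y)) % M ≡⟨ %-remove-+ʳ b M∣a+y ⟩
  b % M             ≡⟨ m<n⇒m%n≡m b<M ⟩
  b                 ∎
  where open ≡-Reasoning

∣+⇒∣%+% : ∀ M .{{_ : NonZero M}} {a b} → M ∣ a + b → M ∣ a % M + b % M
∣+⇒∣%+% M {a} {b} M∣a+b = m%n≡0⇒n∣m _ M (trans (sym (%-distribˡ-+ a b M)) (n∣m⇒m%n≡0 _ M M∣a+b))

sum-map-% : ∀ M .{{_ : NonZero M}} xs → sum (map (_% M) xs) % M ≡ sum xs % M
sum-map-% M [] = refl
sum-map-% M (x ∷ xs) = begin
  (x % M + sum (map (_% M) xs)) % M           ≡⟨ %-distribˡ-+ (x % M) _ M ⟩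
  (x % M % M + sum (map (_% M) xs) % M) % M   ≡⟨ cong₂ (λ a b → (a + b) % M) (m%n%n≡m%n x M) (sum-map-% M xs) ⟩
  (x % M + sum xs % M) % M                    ≡⟨ sym (%-distribˡ-+ x (sum xs) M) ⟩
  (x + sum xs) % M                            ∎
  where open ≡-Reasoning

neg : ∀ {w} .{{_ : NonZero w}} → Fin w → Fin w
neg {w} x = (w ∸ toℕ x) mod w

toℕ-neg : ∀ {w} .{{_ : NonZero w}} (x : Fin w) → toℕ (neg x) ≡ (w ∸ toℕ x) % w
toℕ-neg {w} x = toℕ-fromℕ< (m%n<n (w ∸ toℕ x) w)

neg-inverse : ∀ {w} .{{_ : NonZero w}} (x : Fin w) → w ∣ toℕ (neg x) + toℕ x
neg-inverse {w} x = subst₂ (λ a b → w ∣ a + b) (sym (toℕ-neg x)) (m<n⇒m%n≡m (toℕ<n x))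
  (∣+⇒∣%+% w (∣-reflexive (sym (m∸n+n≡m (<⇒≤ (toℕ<n x))))))

neg-unique : ∀ {w} .{{_ : NonZero w}} {a} (x : Fin w) → a < w → w ∣ a + toℕ x → toℕ (neg x) ≡ a
neg-unique {w} x a<w w∣a+x = residue-unique w (toℕ<n (neg x)) a<w (neg-inverse x) w∣a+x

countNeg≡countEq-neg : ∀ {w} .{{_ : NonZero w}} (z : Fin w) xs → countNeg z xs ≡ countEq z (map neg xs)
countNeg≡countEq-neg z [] = refl
countNeg≡countEq-neg {w} z (x ∷ xs) with w ∣? (toℕ z + toℕ x) | toℕ (neg x) ≟ toℕ z
... | yes _ | yes _ = cong suc (countNeg≡countEq-neg z xs)
... | no _ | no _ = countNeg≡countEq-neg z xs
... | yes w∣z+x | no -x≢z = ⊥-elim (-x≢z (neg-unique x (toℕ<n z) w∣z+x))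
... | no w∤z+x | yes -x≡z = ⊥-elim (w∤z+x (subst (λ a → w ∣ a + toℕ x) -x≡z (neg-inverse x)))

signed : ∀ {w} .{{_ : NonZero w}} → List (Fin w) → List (Fin w)
signed xs = xs ++ map neg xs

multiplicity : ∀ {m n w} .{{_ : NonZero w}} → PFArray m n w → ℕ → ℕ
multiplicity A c = occ c (map toℕ (signed (allEntries A)))

multPM≡multiplicity : ∀ {m n w} .{{_ : NonZero w}} (A : PFArray m n w) z →
  multPM A z ≡ multiplicity A (toℕ z)
multPM≡multiplicity A z = begin
  countEq z E + countNeg z E
    ≡⟨ cong (countEq z E +_) (countNeg≡countEq-neg z E) ⟩
  countEq z E + countEq z (map neg E)
    ≡⟨ cong₂ _+_ (countEq≡occ z E) (countEq≡occ z (map neg E)) ⟩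
  occ (toℕ z) (map toℕ E) + occ (toℕ z) (map toℕ (map neg E))
    ≡⟨ sym (occ-++ (toℕ z) (map toℕ E) _) ⟩
  occ (toℕ z) (map toℕ E ++ map toℕ (map neg E))
    ≡⟨ cong (occ (toℕ z)) (sym (map-++ toℕ E (map neg E))) ⟩
  multiplicity A (toℕ z) ∎
  where
  open ≡-Reasoning
  E = allEntries A

reduce : ∀ {w} W .{{_ : NonZero W}} → Fin w → Fin W
reduce W x = toℕ x mod W

toℕ-reduce : ∀ {w} W .{{_ : NonZero W}} (x : Fin w) → toℕ (reduce W x) ≡ toℕ x % W
toℕ-reduce W x = toℕ-fromℕ< (m%n<n (toℕ x) W)

map-toℕ-reduce : ∀ {w} W .{{_ : NonZero W}} (xs : List (Fin w)) →
  map toℕ (map (reduce W) xs) ≡ map (_% W) (map toℕ xs)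
map-toℕ-reduce W xs = trans (sym (map-∘ xs)) (trans (map-cong (toℕ-reduce W) xs) (map-∘ xs))

reduce-neg : ∀ {w} W .{{_ : NonZero w}} .{{_ : NonZero W}} → W ∣ w →
  (x : Fin w) → reduce W (neg x) ≡ neg (reduce W x)
reduce-neg W W∣w x = toℕ-injective (sym (neg-unique (reduce W x) (toℕ<n (reduce W (neg x))) W∣-x+x))
  where
  W∣-x+x : W ∣ toℕ (reduce W (neg x)) + toℕ (reduce W x)
  W∣-x+x = subst₂ (λ a b → W ∣ a + b) (sym (toℕ-reduce W (neg x))) (sym (toℕ-reduce W x))
    (∣+⇒∣%+% W (∣-trans W∣w (neg-inverse x)))

signed-reduce : ∀ {w} W .{{_ : NonZero w}} .{{_ : NonZero W}} → W ∣ w →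
  (xs : List (Fin w)) → signed (map (reduce W) xs) ≡ map (reduce W) (signed xs)
signed-reduce W W∣w xs = trans (cong (map (reduce W) xs ++_) neg-reduce) (sym (map-++ (reduce W) xs (map neg xs)))
  where
  neg-reduce : map neg (map (reduce W) xs) ≡ map (reduce W) (map neg xs)
  neg-reduce = trans (sym (map-∘ xs)) (trans (map-cong (sym ∘ reduce-neg W W∣w) xs) (map-∘ xs))

reduce-∣sum : ∀ {w} W .{{_ : NonZero W}} → W ∣ w →
  (xs : List (Fin w)) → w ∣ sumℕ xs → W ∣ sumℕ (map (reduce W) xs)
reduce-∣sum W W∣w xs w∣Σxs = m%n≡0⇒n∣m _ W (begin
  sum (map toℕ (map (reduce W) xs)) % W  ≡⟨ cong (λ ys → sum ys % W) (map-toℕ-reduce W xs) ⟩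
  sum (map (_% W) (map toℕ xs)) % W      ≡⟨ sum-map-% W (map toℕ xs) ⟩
  sum (map toℕ xs) % W                   ≡⟨ n∣m⇒m%n≡0 _ W (∣-trans W∣w w∣Σxs) ⟩
  0                                      ∎)
  where open ≡-Reasoning

mapArray : ∀ {m n w w′} → (Fin w → Fin w′) → PFArray m n w → PFArray m n w′
mapArray f A i j = Maybe.map f (A i j)

filled-map : ∀ {w w′} (f : Fin w → Fin w′) xs → filled (map (Maybe.map f) xs) ≡ map f (filled xs)
filled-map f [] = refl
filled-map f (nothing ∷ xs) = filled-map f xs
filled-map f (just x ∷ xs) = cong (f x ∷_) (filled-map f xs)

rowCells-mapArray : ∀ {m n w w′} (f : Fin w → Fin w′) (A : PFArray m n w) i →
  rowCells (mapArray f A) i ≡ map f (rowCells A i)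
rowCells-mapArray {n = n} f A i = trans (cong filled (map-∘ {g = Maybe.map f} {f = A i} (allFin n))) (filled-map f (map (A i) (allFin n)))

colCells-mapArray : ∀ {m n w w′} (f : Fin w → Fin w′) (A : PFArray m n w) j →
  colCells (mapArray f A) j ≡ map f (colCells A j)
colCells-mapArray {m = m} f A j = trans (cong filled (map-∘ {g = Maybe.map f} {f = λ i → A i j} (allFin m))) (filled-map f (map (λ i → A i j) (allFin m)))

allEntries-mapArray : ∀ {m n w w′} (f : Fin w → Fin w′) (A : PFArray m n w) →
  allEntries (mapArray f A) ≡ map f (allEntries A)
allEntries-mapArray {m = m} f A =
  trans (concatMap-cong (rowCells-mapArray f A) (allFin m)) (sym (map-concatMap f (rowCells A) (allFin m)))

multiplicity-reduce : ∀ {m n w} l W .{{_ : NonZero w}} .{{_ : NonZero W}} → w ≡ l * W →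
  (A : PFArray m n w) {c : ℕ} → c < W →
  multiplicity (mapArray (reduce W) A) c ≡ ∑[ j < l ] multiplicity A (c + j * W)
multiplicity-reduce l W w≡lW A {c} c<W = begin
  occ c (map toℕ (signed (allEntries (mapArray (reduce W) A))))
    ≡⟨ cong (occ c ∘ map toℕ ∘ signed) (allEntries-mapArray (reduce W) A) ⟩
  occ c (map toℕ (signed (map (reduce W) E)))
    ≡⟨ cong (occ c ∘ map toℕ) (signed-reduce W (divides l w≡lW) E) ⟩
  occ c (map toℕ (map (reduce W) (signed E)))
    ≡⟨ cong (occ c) (map-toℕ-reduce W (signed E)) ⟩
  occ c (map (_% W) (map toℕ (signed E)))
    ≡⟨ occ-map-% l W c<W (All.map⁺ (universal (λ x → subst (toℕ x <_) w≡lW (toℕ<n x)) (signed E))) ⟩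
  ∑[ j < l ] multiplicity A (c + j * W) ∎
  where
  open ≡-Reasoning
  E = allEntries A

nonZero-+ : ∀ m n .{{_ : NonZero n}} → NonZero (m + n)
nonZero-+ m (suc n) rewrite +-suc m n = _

fibre-bound : ∀ {l W c j} → c < W → j < l → c + j * W < l * W
fibre-bound {W = W} {j = j} c<W j<l = <-≤-trans (+-monoˡ-< (j * W) c<W) (*-monoˡ-≤ W j<l)

inJ-fibre : ∀ l W q c j .{{_ : NonZero l}} → (l * W ∣ l * q * (c + j * W)) ⇔ (W ∣ q * c)
inJ-fibre l W q c j = mk⇔ to from
  where
  split : q * (c + j * W) ≡ q * c + q * (j * W)
  split = *-distribˡ-+ q c (j * W)
  W∣qjW : W ∣ q * (j * W)
  W∣qjW = ∣n⇒∣m*n q (n∣m*n j)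
  to : l * W ∣ l * q * (c + j * W) → W ∣ q * c
  to h = ∣m+n∣m⇒∣n (subst (W ∣_) (trans split (+-comm (q * c) (q * (j * W)))) (*-cancelˡ-∣ l (subst (l * W ∣_) (*-assoc l q _) h))) W∣qjW
  from : W ∣ q * c → l * W ∣ l * q * (c + j * W)
  from h = subst (l * W ∣_) (sym (*-assoc l q _)) (*-monoʳ-∣ l (subst (W ∣_) (sym split) (∣m∣n⇒∣m+n h W∣qjW)))

reduce-isHeffter : ∀ {μ m n s k d d′} l q .{{_ : NonZero l}} .{{_ : NonZero (d + l * q)}} .{{_ : NonZero (d′ + q)}} →
  d ≡ l * d′ → (A : PFArray m n (d + l * q)) → IsHeffter μ (l * q) m n s k d A →
  IsHeffter (l * μ) q m n s k d′ (mapArray (reduce (d′ + q)) A)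
reduce-isHeffter {μ} {d = d} {d′} l q d≡ld′ A H = record
  { rowFill = λ i → trans (cong length (rowCells-mapArray r A i)) (trans (length-map r (rowCells A i)) (rowFill i))
  ; colFill = λ j → trans (cong length (colCells-mapArray r A j)) (trans (length-map r (colCells A j)) (colFill j))
  ; multOut = λ z z∉J → trans (multPM-reduce z) (Σ<-const l μ (λ j j<l →
      trans (multiplicity-lift z j<l) (multOut _ (z∉J ∘ Equivalence.to (inJ-lift z j<l)))))
  ; multIn = λ z z∈J → trans (multPM-reduce z) (trans (Σ<-const l 0 (λ j j<l →
      trans (multiplicity-lift z j<l) (multIn _ (Equivalence.from (inJ-lift z j<l) z∈J)))) (*-zeroʳ l))
  ; rowSum = λ i → subst (λ xs → W ∣ sumℕ xs) (sym (rowCells-mapArray r A i)) (reduce-∣sum W W∣w (rowCells A i) (rowSum i))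
  ; colSum = λ j → subst (λ xs → W ∣ sumℕ xs) (sym (colCells-mapArray r A j)) (reduce-∣sum W W∣w (colCells A j) (colSum j))
  }
  where
  open IsHeffter H
  W = d′ + q
  r = reduce W
  w≡lW : d + l * q ≡ l * W
  w≡lW = trans (cong (_+ l * q) d≡ld′) (sym (*-distribˡ-+ l d′ q))
  W∣w : W ∣ d + l * q
  W∣w = divides l w≡lW
  lift : (z : Fin W) {j : ℕ} → j < l → Fin (d + l * q)
  lift z {j} j<l = fromℕ< (subst (toℕ z + j * W <_) (sym w≡lW) (fibre-bound (toℕ<n z) j<l))
  multPM-reduce : ∀ z → multPM (mapArray r A) z ≡ ∑[ j < l ] multiplicity A (toℕ z + j * W)
  multPM-reduce z = trans (multPM≡multiplicity (mapArray r A) z) (multiplicity-reduce l W w≡lW A (toℕ<n z))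
  multiplicity-lift : ∀ z {j} (j<l : j < l) → multiplicity A (toℕ z + j * W) ≡ multPM A (lift z j<l)
  multiplicity-lift z j<l = trans (cong (multiplicity A) (sym (toℕ-fromℕ< _))) (sym (multPM≡multiplicity A (lift z j<l)))
  inJ-lift : ∀ z {j} (j<l : j < l) → inJ (d + l * q) (l * q) (lift z j<l) ⇔ inJ W q z
  inJ-lift z {j} j<l = subst₂ (λ w c → (w ∣ l * q * c) ⇔ (W ∣ q * toℕ z)) (sym w≡lW) (sym (toℕ-fromℕ< _))
    (inJ-fibre l W q (toℕ z) j)

Heffter-divide : ∀ {μ m n s k} l q .{{_ : NonZero l}} .{{_ : NonZero q}} →
  Heffter μ (l * q) m n s k → Heffter (l * μ) q m n s k
Heffter-divide {μ} l q (.(e * (l * q)) , μd≡2nk , divides e refl , A , H) =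
  e * q , l*μ*d′≡2nk , divides e refl , mapArray (reduce (e * q + q)) A , reduce-isHeffter l q d≡ld′ A H
  where
  instance
    _ : NonZero (e * (l * q) + l * q)
    _ = nonZero-+ (e * (l * q)) (l * q) {{m*n≢0 l q}}
    _ : NonZero (e * q + q)
    _ = nonZero-+ (e * q) q
  d≡ld′ : e * (l * q) ≡ l * (e * q)
  d≡ld′ = *-left-comm e l q
  l*μ*d′≡2nk : l * μ * (e * q) ≡ _
  l*μ*d′≡2nk = trans (cong (_* (e * q)) (*-comm l μ))
    (trans (*-assoc μ l (e * q)) (trans (cong (μ *_) (sym d≡ld′)) μd≡2nk))

corollary4p5 : (m n s k t : ℕ) → 0 < m → 0 < n → 0 < s → 0 < k → 0 < t →
    Heffter 1 t m n s k →
    (λ′ q : ℕ) → 0 < λ′ → λ′ * q ≡ t →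
    Heffter λ′ q m n s k
corollary4p5 m n s k t _ _ _ _ 0<t H l q 0<l lq≡t =
  subst (λ μ → Heffter μ q m n s k) (*-identityʳ l)
    (Heffter-divide l q (subst (λ τ → Heffter 1 τ m n s k) (sym lq≡t) H))
  where
  instance
    _ : NonZero l
    _ = >-nonZero 0<l
    _ : NonZero q
    _ = m*n≢0⇒n≢0 l {{>-nonZero (subst (0 <_) (sym lq≡t) 0<t)}}
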